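{- Let $(G,\lambda)$ be an edge-labeled finite simple graph with $|V_G|\ge2$ such that $\lambda$ is an MAT-labeling of $G$. (1) If $G=K_\ell$ is complete and $e_0$ is an edge of $G$ with maximal label, then both endvertices of $e_0$ are MAT-simplicial. (2) If $G$ is not complete, then $(G,\lambda)$ has two nonadjacent MAT-simplicial vertices.
   Context: An edge-labeled graph is a simple graph $G$ with a map $\lambda:E_G\to\mathbb{Z}_{>0}$. MAT-labeling: put $\pi_k=\lambda^{ -1}(k)$, $E_k=\pi_1\sqcup\dots\sqcup\pi_k$, $E_0=\varnothing$; $\operatorname{cl}(F)$ is the set of edges whose endvertices are joined by a path of edges in $F$; $\lambda$ is an MAT-labeling if for all $k\ge1$: (ML1) $\pi_k$ is a forest; (ML2) $\operatorname{cl}(\pi_k)\cap E_{k-1}=\varnothing$; (ML3) each $\{u,v\}\in\pi_k$ has exactly $k-1$ vertices $w$ with $\{u,w\},\{v,w\}\in E_{k-1}$. A vertex $v$ of $(G,\lambda)$ is MAT-simplicial if: (MS1) its neighborhood $N_G(v)$ is a clique; (MS2) $\{\lambda(\{u,v\})\mid u\in N_G(v)\}=\{1,2,\dots,\deg_G(v)\}$; (MS3) for any distinct $u_1,u_2\in N_G(v)$, $\lambda(\{u_1,u_2\})<\max\{\lambda(\{u_1,v\}),\lambda(\{u_2,v\})\}$. -}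

module Defs where

open import Data.Nat using (ℕ; zero; suc; _+_; _≤_; _<_; _∸_; _⊔_)
open import Data.Fin using (Fin)
open import Data.Bool using (Bool; true; false; T; not; _∧_)
open import Data.List using (List; []; _∷_; length; filterᵇ; allFin)
open import Data.List.Relation.Unary.Unique.Propositional using (Unique)
open import Data.Product using (Σ; _×_; ∃; ∃-syntax)
open import Data.Empty using (⊥)
open import Relation.Nullary using (¬_)
open import Relation.Binary.PropositionalEquality using (_≡_; _≢_)

record Graph (n : ℕ) : Set where
  field
    adj   : Fin n → Fin n → Bool
    sym   : ∀ u v → adj u v ≡ adj v u
    irrefl : ∀ v → adj v v ≡ false
open Graph public

-- An edge labeling λ : E_G → ℤ_{>0}: a function on pairs of vertices which is
-- symmetric on edges and positive on edges (its values on non-edges are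
-- irrelevant and never used).
record Labeling {n : ℕ} (G : Graph n) : Set where
  field
    lab    : Fin n → Fin n → ℕ
    lsym   : ∀ u v → T (adj G u v) → lab u v ≡ lab v u
    lpos   : ∀ u v → T (adj G u v) → 1 ≤ lab u v
open Labeling public

EdgeSet : ℕ → Set₁
EdgeSet n = Fin n → Fin n → Set

module _ {n : ℕ} (G : Graph n) (L : Labeling G) where

  π : ℕ → EdgeSet n
  π k u v = T (adj G u v) × lab L u v ≡ k

  -- E_k = π_1 ⊔ ... ⊔ π_k  (labels are positive, so E_0 = ∅)
  Eup : ℕ → EdgeSet n
  Eup k u v = T (adj G u v) × lab L u v ≤ k

  commonBelow : ℕ → Fin n → Fin n → ℕ
  commonBelow k u v = length (filterᵇ ok (allFin n))
    where
      leb : ℕ → ℕ → Bool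
      leb zero _ = true
      leb (suc a) zero = false
      leb (suc a) (suc b) = leb a b
      ok : Fin n → Bool
      ok w = (adj G u w ∧ leb (lab L u w) k) ∧ (adj G v w ∧ leb (lab L v w) k)

  deg : Fin n → ℕ
  deg v = length (filterᵇ (adj G v) (allFin n))

data Connected {n : ℕ} (F : EdgeSet n) : Fin n → Fin n → Set where
  here  : ∀ {u} → Connected F u u
  step  : ∀ {u v w} → F u v → Connected F v w → Connected F u w

ChainFrom : {n : ℕ} → EdgeSet n → Fin n → List (Fin n) → Fin n → Set
ChainFrom F x [] y = F x y
ChainFrom F x (z ∷ zs) y = F x z × ChainFrom F z zs y

IsCycle : {n : ℕ} → EdgeSet n → List (Fin n) → Set
IsCycle F [] = ⊥
IsCycle F (v₀ ∷ vs) = Unique (v₀ ∷ vs) × 2 ≤ length vs × ChainFrom F v₀ vs v₀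

Forest : {n : ℕ} → EdgeSet n → Set
Forest F = ∀ cs → ¬ IsCycle F cs

module _ {n : ℕ} (G : Graph n) (L : Labeling G) where

  -- cl(F) ∩ E' = ∅ : no edge of E' has endvertices joined by a path in F
  ClDisjoint : EdgeSet n → EdgeSet n → Set
  ClDisjoint F E' = ∀ u v → E' u v → ¬ Connected F u v

  IsMATLabeling : Set
  IsMATLabeling = ∀ k → 1 ≤ k →
      Forest (π G L k)                                        -- (ML1)
    × ClDisjoint (π G L k) (Eup G L (k ∸ 1))                  -- (ML2)
    × (∀ u v → π G L k u v → commonBelow G L (k ∸ 1) u v ≡ k ∸ 1)  -- (ML3)

  IsMATSimplicial : Fin n → Set
  IsMATSimplicial v =
      -- (MS1) N_G(v) is a clique
      (∀ u₁ u₂ → T (adj G v u₁) → T (adj G v u₂) → u₁ ≢ u₂ → T (adj G u₁ u₂))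
      -- (MS2) {λ({u,v}) | u ∈ N(v)} = {1,...,deg v}
    × (∀ u → T (adj G u v) → 1 ≤ lab L u v × lab L u v ≤ deg G L v)
    × (∀ j → 1 ≤ j → j ≤ deg G L v → ∃[ u ] (T (adj G u v) × lab L u v ≡ j))
      -- (MS3)
    × (∀ u₁ u₂ → T (adj G v u₁) → T (adj G v u₂) → u₁ ≢ u₂ →
         lab L u₁ u₂ < lab L u₁ v ⊔ lab L u₂ v)

Complete : {n : ℕ} → Graph n → Set
Complete {n} G = ∀ (u v : Fin n) → u ≢ v → T (adj G u v)

-- A vertex v has distinct labels if the edges at v carry pairwise different
-- labels. Such a vertex is MAT-simplicial: if vu is labelled k + 1, then by (ML3)
-- v and u have exactly k common neighbours w with both labels at most k, while v
-- has at most k neighbours w with lab v w ≤ k; so all of these are adjacent to u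
-- through a smaller label, which gives (MS1), (MS3), and (MS2) by pigeonhole.
--
-- Vertices with distinct labels are found by induction on the number of edges
-- plus the size of a vertex set S carrying all edges. If S is a clique, delete a
-- maximal edge ab: then a, b is the only nonadjacent pair, so it has distinct
-- labels, and a second maximal label at a would lie in a triangle with a third
-- edge of even larger label. Otherwise, deleting a leaf edge of the forest of
-- maximal labels gives one vertex v₀ with distinct labels. Isolating v₀
-- preserves (ML3) by (MS3), and the induction hypothesis for S ∖ v₀ yields a
-- second vertex outside N(v₀); when S ∖ v₀ is a clique this uses that a clique
-- whose maximal label is m has at most m + 1 vertices.

module Submission where

open import Defs hiding (sym)
open import Data.Nat using (ℕ; zero; suc; _+_; _∸_; _≤_; _<_; _⊔_; z≤n; s≤s; _≤ᵇ_; _<ᵇ_; _≡ᵇ_)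
import Data.Nat as ℕ
open import Data.Nat.Properties hiding (_≟_)
open import Data.Fin using (Fin; zero; suc; _≟_)
import Data.Fin.Properties as Fin
open import Data.Bool using (Bool; true; false; T; T?; not; _∧_; _∨_; if_then_else_)
open import Data.Bool.Properties using (∧-identityʳ; ∧-comm; T-∧; T-∨)
open import Data.List using (List; []; _∷_; length; lookup; filterᵇ; allFin; tabulate; cartesianProduct)
open import Data.List.Extrema.Nat using (argmax; f[xs]≤f[argmax])
open import Data.List.Relation.Unary.All using (All; []; _∷_)
import Data.List.Relation.Unary.All as All
open import Data.List.Relation.Unary.All.Properties using (anti-mono; ¬Any⇒All¬)
open import Data.List.Relation.Unary.AllPairs using ([]; _∷_)
open import Data.List.Relation.Unary.Any using (here; there; any?)
open import Data.List.Relation.Unary.Linked using (Linked; []; [-]; _∷_)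
open import Data.List.Relation.Unary.Unique.Propositional using (Unique)
open import Data.List.Membership.Propositional using (_∈_)
open import Data.List.Membership.Propositional.Properties using (∈-lookup; ∈-allFin; ∈-cartesianProduct⁺)
open import Data.Product using (Σ; _×_; _,_; proj₁; proj₂; ∃-syntax)
open import Data.Sum using (_⊎_; inj₁; inj₂)
open import Data.Empty using (⊥; ⊥-elim)
open import Function using (_∘_; id; const; Equivalence)
open import Relation.Nullary using (¬_; ¬?; Dec; yes; no; does; _×-dec_; _⊎-dec_)
open import Relation.Nullary.Decidable using (isNo; decidable-stable; toWitnessFalse; fromWitnessFalse)
open import Relation.Binary using (tri<; tri≈; tri>)
open import Relation.Binary.PropositionalEquality

private variable n : ℕ

-- Counting over Fin n

count : (Fin n → Bool) → ℕ
count {zero}  p = 0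
count {suc n} p = (if p zero then 1 else 0) + count (p ∘ suc)

length-filter-tabulate : ∀ {A : Set} (p : A → Bool) (f : Fin n → A) →
  length (filterᵇ p (tabulate f)) ≡ count (p ∘ f)
length-filter-tabulate {zero}  p f = refl
length-filter-tabulate {suc n} p f with p (f zero)
... | true  = cong suc (length-filter-tabulate p (f ∘ suc))
... | false = length-filter-tabulate p (f ∘ suc)

length-filter-allFin : (p : Fin n → Bool) → length (filterᵇ p (allFin n)) ≡ count p
length-filter-allFin p = length-filter-tabulate p id

count-cong : {p q : Fin n → Bool} → (∀ x → p x ≡ q x) → count p ≡ count q
count-cong {zero}  e = refl
count-cong {suc n} e = cong₂ (λ b c → (if b then 1 else 0) + c) (e zero) (count-cong (e ∘ suc))

count-mono : {p q : Fin n → Bool} → (∀ x → T (p x) → T (q x)) → count p ≤ count q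
count-mono {zero}  p⊆q = z≤n
count-mono {suc n} {p} {q} p⊆q with p zero | q zero | p⊆q zero
... | true  | true  | _ = s≤s (count-mono (p⊆q ∘ suc))
... | false | true  | _ = m≤n⇒m≤1+n (count-mono (p⊆q ∘ suc))
... | false | false | _ = count-mono (p⊆q ∘ suc)
... | true  | false | f = ⊥-elim (f _)

count-strict : {p q : Fin n → Bool} → (∀ x → T (p x) → T (q x)) →
  ∀ a → T (q a) → ¬ T (p a) → count p < count q
count-strict {suc n} {p} {q} p⊆q zero qa ¬pa with p zero | q zero
... | true  | _     = ⊥-elim (¬pa _)
... | false | true  = s≤s (count-mono (p⊆q ∘ suc))
... | false | false = ⊥-elim qa
count-strict {suc n} {p} {q} p⊆q (suc a) qa ¬pa with p zero | q zero | p⊆q zero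
... | true  | true  | _ = s≤s (count-strict (p⊆q ∘ suc) a qa ¬pa)
... | false | true  | _ = m<n⇒m<1+n (count-strict (p⊆q ∘ suc) a qa ¬pa)
... | false | false | _ = count-strict (p⊆q ∘ suc) a qa ¬pa
... | true  | false | f = ⊥-elim (f _)

count-none : {p : Fin n → Bool} → (∀ x → ¬ T (p x)) → count p ≡ 0
count-none {zero}  none = refl
count-none {suc n} {p} none with p zero | none zero
... | true  | f = ⊥-elim (f _)
... | false | _ = count-none (none ∘ suc)

count-∨ : (p q : Fin n → Bool) → count (λ x → p x ∨ q x) ≤ count p + count q
count-∨ {zero}  p q = z≤n
count-∨ {suc n} p q with p zero | q zero
... | true  | true  = s≤s (≤-trans (m≤n⇒m≤1+n (count-∨ (p ∘ suc) (q ∘ suc))) (≤-reflexive (sym (+-suc _ _))))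
... | true  | false = s≤s (count-∨ (p ∘ suc) (q ∘ suc))
... | false | true  = ≤-trans (s≤s (count-∨ (p ∘ suc) (q ∘ suc))) (≤-reflexive (sym (+-suc _ _)))
... | false | false = count-∨ (p ∘ suc) (q ∘ suc)

count-≤1 : {p : Fin n → Bool} → (∀ x y → T (p x) → T (p y) → x ≡ y) → count p ≤ 1
count-≤1 {zero}  unique = z≤n
count-≤1 {suc n} {p} unique with p zero in eq
... | true  = ≤-reflexive (cong suc (count-none (λ x px → Fin.0≢1+n (unique zero (suc x) (subst T (sym eq) _) px))))
... | false = count-≤1 (λ x y px py → Fin.suc-injective (unique (suc x) (suc y) px py))

infixl 20 _∖_
_∖_ : (Fin n → Bool) → Fin n → Fin n → Bool
(p ∖ a) x = p x ∧ not (does (x ≟ a))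

count-∖ : (p : Fin n → Bool) (a : Fin n) → T (p a) → count p ≡ suc (count (p ∖ a))
count-∖ {suc n} p zero pa with p zero
... | true = cong suc (count-cong (λ x → sym (∧-identityʳ (p (suc x)))))
count-∖ {suc n} p (suc a) pa with p zero
... | true  = cong suc (count-∖ (p ∘ suc) a pa)
... | false = count-∖ (p ∘ suc) a pa

module _ (p : Fin n → Bool) {a x : Fin n} where

  ∖⁻ : T ((p ∖ a) x) → T (p x) × x ≢ a
  ∖⁻ t with x ≟ a
  ... | yes _  = ⊥-elim (proj₂ (Equivalence.to T-∧ t))
  ... | no x≢a = proj₁ (Equivalence.to T-∧ t) , x≢a

  ∖⁺ : T (p x) → x ≢ a → T ((p ∖ a) x)
  ∖⁺ px x≢a with x ≟ a
  ... | yes x≡a = ⊥-elim (x≢a x≡a)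
  ... | no _    = Equivalence.from T-∧ (px , _)

sumᶠ : (Fin n → ℕ) → ℕ
sumᶠ {zero}  f = 0
sumᶠ {suc n} f = f zero + sumᶠ (f ∘ suc)

sumᶠ-mono : {f g : Fin n → ℕ} → (∀ x → f x ≤ g x) → sumᶠ f ≤ sumᶠ g
sumᶠ-mono {zero}  f≤g = z≤n
sumᶠ-mono {suc n} f≤g = +-mono-≤ (f≤g zero) (sumᶠ-mono (f≤g ∘ suc))

sumᶠ-strict : {f g : Fin n → ℕ} → (∀ x → f x ≤ g x) → ∀ a → f a < g a → sumᶠ f < sumᶠ g
sumᶠ-strict {suc n} f≤g zero    lt = +-mono-<-≤ lt (sumᶠ-mono (f≤g ∘ suc))
sumᶠ-strict {suc n} f≤g (suc a) lt = +-mono-≤-< (f≤g zero) (sumᶠ-strict (f≤g ∘ suc) a lt)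

module InjectiveLabels {p : Fin n → Bool} {f : Fin n → ℕ}
  (injective : ∀ x y → T (p x) → T (p y) → f x ≡ f y → x ≡ y)
  (positive : ∀ x → T (p x) → 1 ≤ f x) where

  Below : ℕ → Fin n → Bool
  Below j x = p x ∧ (f x ≤ᵇ j)

  Below⁻ : ∀ {j x} → T (Below j x) → T (p x) × f x ≤ j
  Below⁻ t = let (px , le) = Equivalence.to T-∧ t in px , ≤ᵇ⇒≤ _ _ le

  Below⁺ : ∀ {j x} → T (p x) → f x ≤ j → T (Below j x)
  Below⁺ px le = Equivalence.from T-∧ (px , ≤⇒≤ᵇ le)

  private
    At : ℕ → Fin n → Bool
    At j x = p x ∧ (f x ≡ᵇ j)

    At⁻ : ∀ {j x} → T (At j x) → T (p x) × f x ≡ j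
    At⁻ t = let (px , e) = Equivalence.to T-∧ t in px , ≡ᵇ⇒≡ _ _ e

    Below-suc : ∀ j x → T (Below (suc j) x) → T (Below j x ∨ At (suc j) x)
    Below-suc j x t with Below⁻ t
    ... | px , le with m≤n⇒m<n∨m≡n le
    ...   | inj₁ lt = Equivalence.from T-∨ (inj₁ (Below⁺ px (≤-pred lt)))
    ...   | inj₂ eq = Equivalence.from T-∨ (inj₂ (Equivalence.from T-∧ (px , ≡⇒≡ᵇ _ _ eq)))

  count-Below-suc : ∀ j → count (Below (suc j)) ≤ count (Below j) + 1
  count-Below-suc j = ≤-trans (count-mono (Below-suc j)) (≤-trans (count-∨ (Below j) (At (suc j)))
    (+-monoʳ-≤ (count (Below j)) (count-≤1 λ x y tx ty →
      let (px , fx) = At⁻ tx ; (py , fy) = At⁻ ty in injective x y px py (trans fx (sym fy)))))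

  count-Below-+ : ∀ j s → count (Below (j + s)) ≤ count (Below j) + s
  count-Below-+ j zero    = ≤-reflexive (trans (cong (count ∘ Below) (+-identityʳ j)) (sym (+-identityʳ _)))
  count-Below-+ j (suc s) = begin
    count (Below (j + suc s))     ≡⟨ cong (count ∘ Below) (+-suc j s) ⟩
    count (Below (suc (j + s)))   ≤⟨ count-Below-suc (j + s) ⟩
    count (Below (j + s)) + 1     ≤⟨ +-monoˡ-≤ 1 (count-Below-+ j s) ⟩
    count (Below j) + s + 1       ≡⟨ +-assoc (count (Below j)) s 1 ⟩
    count (Below j) + (s + 1)     ≡⟨ cong (count (Below j) +_) (+-comm s 1) ⟩
    count (Below j) + suc s       ∎
    where open ≤-Reasoning

  count-Below-≤ : ∀ j → count (Below j) ≤ j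
  count-Below-≤ j = begin
    count (Below (0 + j)) ≤⟨ count-Below-+ 0 j ⟩
    count (Below 0) + j   ≡⟨ cong (_+ j) (count-none λ x t → let (px , le) = Below⁻ t in <⇒≱ (positive x px) le) ⟩
    j                     ∎
    where open ≤-Reasoning

  onto : (∀ x → T (p x) → f x ≤ count p) → ∀ j → 1 ≤ j → j ≤ count p → ∃[ x ] T (p x) × f x ≡ j
  onto bounded (suc j) _ j<d with Fin.any? (λ x → T? (At (suc j) x))
  ... | yes (x , t) = x , At⁻ t
  ... | no missed = ⊥-elim (<-irrefl refl (begin-strict
    d                               ≤⟨ count-mono (λ x px → Below⁺ px (bounded x px)) ⟩
    count (Below d)                 ≡⟨ cong (count ∘ Below) (m+[n∸m]≡n j<d) ⟨
    count (Below (suc j + (d ∸ suc j))) ≤⟨ count-Below-+ (suc j) (d ∸ suc j) ⟩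
    count (Below (suc j)) + (d ∸ suc j) ≤⟨ +-monoˡ-≤ _ (count-mono (skip missed)) ⟩
    count (Below j) + (d ∸ suc j)   ≤⟨ +-monoˡ-≤ _ (count-Below-≤ j) ⟩
    j + (d ∸ suc j)                 <⟨ +-monoˡ-< _ (n<1+n j) ⟩
    suc j + (d ∸ suc j)             ≡⟨ m+[n∸m]≡n j<d ⟩
    d                               ∎))
    where
      open ≤-Reasoning
      d : ℕ
      d = count p
      skip : ¬ (∃[ x ] T (At (suc j) x)) → ∀ x → T (Below (suc j) x) → T (Below j x)
      skip missed x t with Equivalence.to T-∨ (Below-suc j x t)
      ... | inj₁ below = below
      ... | inj₂ at    = ⊥-elim (missed (x , at))

CommonBelow : ∀ {n} (G : Graph n) → Labeling G → ℕ → Fin n → Fin n → Fin n → Bool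
CommonBelow G L k u v w = (adj G u w ∧ (lab L u w ≤ᵇ k)) ∧ (adj G v w ∧ (lab L v w ≤ᵇ k))

private
  LocalLeb : Set
  LocalLeb = ∀ {n} (G : Graph n) → Labeling G → ℕ → Fin n → Fin n → ℕ → ℕ → Bool

  LocalCommon : Set
  LocalCommon = ∀ {n} (G : Graph n) → Labeling G → ℕ → Fin n → Fin n → Fin n → Bool

  localCommon : Σ LocalCommon λ ok → ∀ {n} (G : Graph n) L k u v →
    commonBelow G L k u v ≡ length (filterᵇ (ok G L k u v) (allFin n))
  localCommon = _ , λ _ _ _ _ _ → refl

  -- commonBelow compares labels with a Boolean order local to its where-block,
  -- which cannot be named. The meta localLeb is solved to it by the type of
  -- localCommon-unfold: after abstracting a label suc a and the bound d = suc k,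
  -- that order occurs there applied to variables only.
  mutual
    localLeb : LocalLeb
    localLeb = _

    localCommon-unfold : ∀ {n} (G : Graph n) L k (u v w : Fin n) a → lab L u w ≡ suc a →
      proj₁ localCommon G L (suc k) u v w
        ≡ (adj G u w ∧ localLeb G L (suc k) u v a k) ∧ (adj G v w ∧ localLeb G L (suc k) u v (lab L v w) (suc k))
    localCommon-unfold G L k u v w a eq with lab L u w | eq
    ... | _ | refl with suc k
    ... | d = refl

  ≤ᵇ-suc : ∀ a b → (a ≤ᵇ b) ≡ (a <ᵇ suc b)
  ≤ᵇ-suc zero    b = refl
  ≤ᵇ-suc (suc a) b = refl

  localLeb≡≤ᵇ : ∀ {n} (G : Graph n) L d (u v : Fin n) a b → localLeb G L d u v a b ≡ (a ≤ᵇ b)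
  localLeb≡≤ᵇ G L d u v zero    b       = refl
  localLeb≡≤ᵇ G L d u v (suc a) zero    = refl
  localLeb≡≤ᵇ G L d u v (suc a) (suc b) = trans (localLeb≡≤ᵇ G L d u v a b) (≤ᵇ-suc a b)

commonBelow≡count : ∀ {n} (G : Graph n) L k (u v : Fin n) → commonBelow G L k u v ≡ count (CommonBelow G L k u v)
commonBelow≡count {n} G L k u v = trans (proj₂ localCommon G L k u v)
  (trans (length-filter-allFin (proj₁ localCommon G L k u v)) (count-cong λ w →
    cong₂ (λ x y → (adj G u w ∧ x) ∧ (adj G v w ∧ y))
      (localLeb≡≤ᵇ G L k u v (lab L u w) k) (localLeb≡≤ᵇ G L k u v (lab L v w) k)))

module _ (G : Graph n) where

  adj-sym : ∀ {x y} → T (adj G x y) → T (adj G y x)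
  adj-sym {x} {y} = subst T (Graph.sym G x y)

  adj⇒≢ : ∀ {x y} → T (adj G x y) → x ≢ y
  adj⇒≢ {x} xy refl = subst T (irrefl G x) xy

Within : Graph n → (Fin n → Bool) → Set
Within G S = ∀ x y → T (adj G x y) → T (S x)

CliqueOn : Graph n → (Fin n → Bool) → Set
CliqueOn G S = ∀ x y → T (S x) → T (S y) → x ≢ y → T (adj G x y)

IsMaxEdge : (G : Graph n) → Labeling G → Fin n → Fin n → Set
IsMaxEdge G L a b = T (adj G a b) × (∀ c d → T (adj G c d) → lab L c d ≤ lab L a b)

module _ (G : Graph n) (L : Labeling G) {k : ℕ} {u v w : Fin n} where

  CommonBelow⁻ : T (CommonBelow G L k u v w) →
    (T (adj G u w) × lab L u w ≤ k) × (T (adj G v w) × lab L v w ≤ k)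
  CommonBelow⁻ t = let (uw , vw) = Equivalence.to T-∧ t in below uw , below vw
    where
      below : ∀ {x} → T (adj G x w ∧ (lab L x w ≤ᵇ k)) → T (adj G x w) × lab L x w ≤ k
      below t = let (a , l) = Equivalence.to T-∧ t in a , ≤ᵇ⇒≤ _ _ l

  CommonBelow⁺ : T (adj G u w) → lab L u w ≤ k → T (adj G v w) → lab L v w ≤ k →
    T (CommonBelow G L k u v w)
  CommonBelow⁺ uw uk vw vk =
    Equivalence.from T-∧ (Equivalence.from T-∧ (uw , ≤⇒≤ᵇ uk) , Equivalence.from T-∧ (vw , ≤⇒≤ᵇ vk))

deg≡count : ∀ (G : Graph n) L v → deg G L v ≡ count (adj G v)
deg≡count G L v = length-filter-allFin (adj G v)

IsMaxEdge-sym : ∀ {G : Graph n} {L : Labeling G} {c d} → IsMaxEdge G L c d → IsMaxEdge G L d c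
IsMaxEdge-sym {G = G} {L} {c} {d} (cd , max) =
  adj-sym G cd , λ x y xy → subst (lab L x y ≤_) (lsym L c d cd) (max x y xy)

max-edge : ∀ {G : Graph n} (L : Labeling G) {a b} → T (adj G a b) → ∃[ c ] ∃[ d ] IsMaxEdge G L c d
max-edge {n} {G} L {a} {b} ab = c , d , cd , λ x y xy → subst₂ _≤_ (weight-adj xy) (weight-adj cd) (heaviest x y)
  where
    weight : Fin n × Fin n → ℕ
    weight (x , y) = if adj G x y then lab L x y else 0
    weight-adj : ∀ {x y} → T (adj G x y) → weight (x , y) ≡ lab L x y
    weight-adj {x} {y} xy with adj G x y
    ... | true = refl
    pairs : List (Fin n × Fin n)
    pairs = cartesianProduct (allFin n) (allFin n)
    c d : Fin n
    c = proj₁ (argmax weight (a , b) pairs)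
    d = proj₂ (argmax weight (a , b) pairs)
    heaviest : ∀ x y → weight (x , y) ≤ weight (c , d)
    heaviest x y = All.lookup (f[xs]≤f[argmax] (a , b) pairs) (∈-cartesianProduct⁺ (∈-allFin x) (∈-allFin y))
    cd : T (adj G c d)
    cd with adj G c d in eq
    ... | true  = _
    ... | false = ⊥-elim (<⇒≱ (lpos L a b ab)
      (subst₂ _≤_ (weight-adj ab) (cong (λ e → if e then lab L c d else 0) eq) (heaviest a b)))

DistinctLabelsAt : (G : Graph n) → Labeling G → Fin n → Set
DistinctLabelsAt G L v = ∀ u w → T (adj G v u) → T (adj G v w) → lab L v u ≡ lab L v w → u ≡ w

-- Forests have leaves

Unique⇒length≤ : {xs : List (Fin n)} → Unique xs → length xs ≤ n
Unique⇒length≤ {n} {xs} u = Fin.injective⇒≤ (lookup-injective u)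
  where
    lookup-injective : ∀ {xs : List (Fin n)} → Unique xs → ∀ {i j} → lookup xs i ≡ lookup xs j → i ≡ j
    lookup-injective (_ ∷ _)   {zero}  {zero}  _ = refl
    lookup-injective (x≢ ∷ _)  {zero}  {suc j} e = ⊥-elim (All.lookup x≢ (∈-lookup j) e)
    lookup-injective (x≢ ∷ _)  {suc i} {zero}  e = ⊥-elim (All.lookup x≢ (∈-lookup i) (sym e))
    lookup-injective (_ ∷ u)   {suc i} {suc j} e = cong suc (lookup-injective u e)

module _ {F : EdgeSet n} (F? : ∀ x y → Dec (F x y)) (F-sym : ∀ {x y} → F x y → F y x)
         (F-irrefl : ∀ {x} → ¬ F x x) (forest : Forest F) where

  private
    chain-through : ∀ {s x z q} → Linked F (s ∷ q) → Unique q → z ∈ q → F z x →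
      ∃[ vs ] ChainFrom F s vs x × Unique vs × (∀ {e} → e ∈ vs → e ∈ q) × 1 ≤ length vs
    chain-through {q = y ∷ _} (sy ∷ _) _ (here refl) zx =
      y ∷ [] , (sy , zx) , [] ∷ [] , (λ { (here refl) → here refl }) , s≤s z≤n
    chain-through {q = y ∷ _} (sy ∷ linked) (y∉q ∷ unique) (there z∈q) zx
      with chain-through linked unique z∈q zx
    ... | vs , chain , unique-vs , vs⊆q , _ =
      y ∷ vs , (sy , chain) , anti-mono vs⊆q y∉q ∷ unique-vs ,
      (λ { (here refl) → here refl ; (there e∈vs) → there (vs⊆q e∈vs) }) , s≤s z≤n

    walk : ∀ fuel x y rest → Linked F (x ∷ y ∷ rest) → Unique (x ∷ y ∷ rest) →
      n < length (x ∷ y ∷ rest) + fuel → ∃[ u ] ∃[ v ] F u v × (∀ w → F u w → w ≡ v)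
    walk fuel x y rest path@(xy ∷ path′) unique bound
      with Fin.any? (λ z → F? x z ×-dec ¬? (z ≟ y))
    ... | no no-other =
      x , y , xy , λ w xw → decidable-stable (w ≟ y) (λ w≢y → no-other (w , xw , w≢y))
    ... | yes (z , xz , z≢y) with any? (z ≟_) rest
    walk fuel x y rest (xy ∷ path′) unique@((x≢y ∷ x∉rest) ∷ (y∉rest ∷ unique-rest)) bound
        | yes (z , xz , z≢y) | yes z∈rest
        with chain-through path′ unique-rest z∈rest (F-sym xz)
    ... | vs , chain , unique-vs , vs⊆rest , nonempty =
      ⊥-elim (forest (x ∷ y ∷ vs)
        ( ((x≢y ∷ anti-mono vs⊆rest x∉rest) ∷ anti-mono vs⊆rest y∉rest ∷ unique-vs)
        , s≤s nonempty , xy , chain))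
    walk zero x y rest path unique bound | yes _ | no _ =
      ⊥-elim (<⇒≱ (subst (n <_) (+-identityʳ _) bound) (Unique⇒length≤ unique))
    walk (suc fuel) x y rest path unique bound | yes (z , xz , z≢y) | no z∉rest =
      walk fuel z x (y ∷ rest) (F-sym xz ∷ path) (z∉path ∷ unique)
        (subst (n <_) (+-suc (length (x ∷ y ∷ rest)) fuel) bound)
      where
        z∉path : All (z ≢_) (x ∷ y ∷ rest)
        z∉path = (λ { refl → F-irrefl xz }) ∷ z≢y ∷ ¬Any⇒All¬ rest z∉rest

  -- Extend a path at its head x until x has no neighbour besides its successor:
  -- a neighbour further along the path closes a cycle, and paths are short.
  forest-leaf : ∀ {a b} → F a b → ∃[ u ] ∃[ v ] F u v × (∀ w → F u w → w ≡ v)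
  forest-leaf {a} {b} ab =
    walk n b a [] (F-sym ab ∷ [-]) ((≢-sym (λ { refl → F-irrefl ab }) ∷ []) ∷ [] ∷ []) (s≤s (n≤1+n n))

-- Consequences of (ML1)–(ML3)

module MATLabeling {G : Graph n} {L : Labeling G} (mat : IsMATLabeling G L) where

  lab-suc : ∀ {u v} → T (adj G u v) → ∃[ k ] lab L u v ≡ suc k
  lab-suc {u} {v} uv with lab L u v | lpos L u v uv
  ... | suc k | _ = k , refl

  common-count : ∀ {k u v} → T (adj G u v) → lab L u v ≡ suc k → count (CommonBelow G L k u v) ≡ k
  common-count {k} {u} {v} uv uv≡1+k =
    trans (sym (commonBelow≡count G L k u v)) (proj₂ (proj₂ (mat (suc k) (s≤s z≤n))) u v (uv , uv≡1+k))

  lab-triangle : ∀ {x y z} → T (adj G x y) → T (adj G x z) → T (adj G y z) →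
    lab L x y ≡ lab L x z → lab L x y < lab L y z
  lab-triangle {x} {y} {z} xy xz yz xy≡xz with lab L x y in xy≡m | lpos L x y xy
  ... | suc k | _ with mat (suc k) (s≤s z≤n) | <-cmp (lab L y z) (suc k)
  ... | _ , π-path-free , _ | tri< yz<m _ _ =
    ⊥-elim (π-path-free y z (yz , ≤-pred yz<m) (step (adj-sym G xy , yx≡m) (step (xz , sym xy≡xz) here)))
    where
      yx≡m : lab L y x ≡ suc k
      yx≡m = trans (sym (lsym L x y xy)) xy≡m
  ... | π-forest , _ | tri≈ _ yz≡m _ =
    ⊥-elim (π-forest (x ∷ y ∷ z ∷ []) (distinct , s≤s (s≤s z≤n) , (xy , xy≡m) , (yz , yz≡m) , zx))
    where
      distinct : Unique (x ∷ y ∷ z ∷ [])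
      distinct = (adj⇒≢ G xy ∷ adj⇒≢ G xz ∷ []) ∷ (adj⇒≢ G yz ∷ []) ∷ [] ∷ []
      zx : π G L (suc k) z x
      zx = adj-sym G xz , trans (sym (lsym L x z xz)) (sym xy≡xz)
  ... | _ | tri> _ _ m<yz = m<yz

  lab-≤-deg : ∀ {v u} → T (adj G v u) → lab L v u ≤ deg G L v
  lab-≤-deg {v} {u} vu =
    let (k , vu≡1+k) = lab-suc vu
    in subst₂ _≤_ (trans (cong suc (common-count vu vu≡1+k)) (sym vu≡1+k)) (sym (deg≡count G L v))
         (count-strict (λ w c → proj₁ (proj₁ (CommonBelow⁻ G L c))) u vu
           (λ c → adj⇒≢ G (proj₁ (proj₂ (CommonBelow⁻ G L c))) refl))

  max-edge-triangle : ∀ {c d w} → IsMaxEdge G L c d → T (adj G c w) → T (adj G d w) →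
    lab L c w < lab L c d
  max-edge-triangle {c} {d} {w} (cd , max) cw dw = ≤∧≢⇒< (max c w cw) λ cw≡cd →
    <⇒≱ (lab-triangle cd cw dw (sym cw≡cd)) (max d w dw)

  -- The vertices of S other than c and d are common neighbours of c and d with
  -- smaller labels, and there are exactly lab c d ∸ 1 of those by (ML3).
  clique-count-≤ : ∀ {S c d} → Within G S → CliqueOn G S → IsMaxEdge G L c d →
    count S ≤ suc (lab L c d)
  clique-count-≤ {S} {c} {d} within clique max@(cd , _) = begin
    count S                           ≡⟨ count-∖ S c Sc ⟩
    suc (count (S ∖ c))               ≡⟨ cong suc (count-∖ (S ∖ c) d (∖⁺ S Sd (≢-sym c≢d))) ⟩
    2 + count (S ∖ c ∖ d)             ≤⟨ +-monoʳ-≤ 2 (count-mono common) ⟩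
    2 + count (CommonBelow G L k c d) ≡⟨ cong (2 +_) (common-count cd cd≡1+k) ⟩
    2 + k                             ≡⟨ cong suc cd≡1+k ⟨
    suc (lab L c d)                   ∎
    where
      open ≤-Reasoning
      k : ℕ
      k = proj₁ (lab-suc cd)
      cd≡1+k : lab L c d ≡ suc k
      cd≡1+k = proj₂ (lab-suc cd)
      Sc : T (S c)
      Sc = within c d cd
      Sd : T (S d)
      Sd = within d c (adj-sym G cd)
      c≢d : c ≢ d
      c≢d = adj⇒≢ G cd
      common : ∀ w → T ((S ∖ c ∖ d) w) → T (CommonBelow G L k c d w)
      common w t with ∖⁻ (S ∖ c) t
      ... | w∈S∖c , w≢d with ∖⁻ S w∈S∖c
      ...   | w∈S , w≢c = CommonBelow⁺ G L cw (below cw<cd) dw (below dw<cd)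
        where
          cw : T (adj G c w)
          cw = clique c w Sc w∈S (≢-sym w≢c)
          dw : T (adj G d w)
          dw = clique d w Sd w∈S (≢-sym w≢d)
          cw<cd : lab L c w < lab L c d
          cw<cd = max-edge-triangle max cw dw
          dw<cd : lab L d w < lab L c d
          dw<cd = subst (lab L d w <_) (lsym L d c (adj-sym G cd))
                    (max-edge-triangle (IsMaxEdge-sym {L = L} max) dw cw)
          below : ∀ {l} → l < lab L c d → l ≤ k
          below l<cd = ≤-pred (subst (_ <_) cd≡1+k l<cd)

module _ {G : Graph n} {L : Labeling G} (mat : IsMATLabeling G L) {v : Fin n}
         (distinct : DistinctLabelsAt G L v) where
  open MATLabeling {G = G} {L = L} mat
  open InjectiveLabels {p = adj G v} {f = lab L v} distinct (λ u → lpos L v u)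

  -- The common neighbours of v and u below lab v u ∸ 1 are among the at most
  -- lab v u ∸ 1 neighbours of v below it, and by (ML3) they are as many.
  lower-neighbour-common : ∀ {u w k} → T (adj G v u) → lab L v u ≡ suc k →
    T (adj G v w) → lab L v w ≤ k → T (adj G u w) × lab L u w ≤ k
  lower-neighbour-common {u} {w} {k} vu vu≡1+k vw vw≤k with T? (CommonBelow G L k v u w)
  ... | yes common = proj₂ (CommonBelow⁻ G L common)
  ... | no ¬common = ⊥-elim (<-irrefl refl (begin-strict
    k                                  ≡⟨ common-count vu vu≡1+k ⟨
    count (CommonBelow G L k v u)      <⟨ count-strict (λ x c → Below⁺ (proj₁ (proj₁ (CommonBelow⁻ G L c)))
                                                                      (proj₂ (proj₁ (CommonBelow⁻ G L c))))
                                                       w (Below⁺ vw vw≤k) ¬common ⟩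
    count (Below k)                    ≤⟨ count-Below-≤ k ⟩
    k                                  ∎))
    where open ≤-Reasoning

  private
    toward-larger : ∀ {u₁ u₂} → T (adj G v u₁) → T (adj G v u₂) → lab L v u₁ < lab L v u₂ →
      T (adj G u₂ u₁) × lab L u₂ u₁ < lab L u₂ v
    toward-larger {u₁} {u₂} vu₁ vu₂ lt =
      let (k , vu₂≡1+k) = lab-suc vu₂
          (u₂u₁ , u₂u₁≤k) = lower-neighbour-common vu₂ vu₂≡1+k vu₁ (≤-pred (subst (lab L v u₁ <_) vu₂≡1+k lt))
      in u₂u₁ , subst (lab L u₂ u₁ <_) (trans (sym vu₂≡1+k) (lsym L v u₂ vu₂)) (s≤s u₂u₁≤k)

  neighbours-adjacent : ∀ u₁ u₂ → T (adj G v u₁) → T (adj G v u₂) → u₁ ≢ u₂ →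
    T (adj G u₁ u₂) × lab L u₁ u₂ < lab L u₁ v ⊔ lab L u₂ v
  neighbours-adjacent u₁ u₂ vu₁ vu₂ u₁≢u₂ with <-cmp (lab L v u₁) (lab L v u₂)
  ... | tri≈ _ eq _ = ⊥-elim (u₁≢u₂ (distinct u₁ u₂ vu₁ vu₂ eq))
  ... | tri< lt _ _ = let (u₂u₁ , lt′) = toward-larger vu₁ vu₂ lt in
    adj-sym G u₂u₁ , m<n⇒m<o⊔n (lab L u₁ v) (subst (_< lab L u₂ v) (lsym L u₂ u₁ u₂u₁) lt′)
  ... | tri> _ _ gt = let (u₁u₂ , lt′) = toward-larger vu₂ vu₁ gt in
    u₁u₂ , m<n⇒m<n⊔o (lab L u₂ v) lt′

  distinct⇒MAT-simplicial : IsMATSimplicial G L v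
  distinct⇒MAT-simplicial =
      (λ u₁ u₂ vu₁ vu₂ u₁≢u₂ → proj₁ (neighbours-adjacent u₁ u₂ vu₁ vu₂ u₁≢u₂))
    , (λ u uv → lpos L u v uv , subst (_≤ deg G L v) (lsym L v u (adj-sym G uv)) (lab-≤-deg (adj-sym G uv)))
    , (λ j 1≤j j≤deg → let (u , vu , vu≡j) = onto bounded j 1≤j (subst (j ≤_) (deg≡count G L v) j≤deg)
                       in u , adj-sym G vu , trans (lsym L u v (adj-sym G vu)) vu≡j)
    , (λ u₁ u₂ vu₁ vu₂ u₁≢u₂ → proj₂ (neighbours-adjacent u₁ u₂ vu₁ vu₂ u₁≢u₂))
    where
      bounded : ∀ u → T (adj G v u) → lab L v u ≤ count (adj G v)
      bounded u vu = subst (lab L v u ≤_) (deg≡count G L v) (lab-≤-deg vu)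

-- Deleting edges

_⊆ᴱ_ : EdgeSet n → EdgeSet n → Set
F ⊆ᴱ F′ = ∀ {x y} → F x y → F′ x y

module _ {F F′ : EdgeSet n} (F⊆F′ : F ⊆ᴱ F′) where

  ChainFrom-mono : ∀ x vs y → ChainFrom F x vs y → ChainFrom F′ x vs y
  ChainFrom-mono x []       y xy          = F⊆F′ xy
  ChainFrom-mono x (z ∷ zs) y (xz , chain) = F⊆F′ xz , ChainFrom-mono z zs y chain

  Forest-anti-mono : Forest F′ → Forest F
  Forest-anti-mono forest (v ∷ vs) (unique , long , chain) =
    forest (v ∷ vs) (unique , long , ChainFrom-mono v vs v chain)

  Connected-mono : ∀ {x y} → Connected F x y → Connected F′ x y
  Connected-mono here         = here
  Connected-mono (step e path) = step (F⊆F′ e) (Connected-mono path)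

record EdgeFilter (n : ℕ) : Set where
  field
    keep     : Fin n → Fin n → Bool
    keep-sym : ∀ x y → keep x y ≡ keep y x
open EdgeFilter using (keep)

infixl 5 _↾_ _↾ˡ_

_↾_ : Graph n → EdgeFilter n → Graph n
G ↾ K = record
  { adj    = λ x y → adj G x y ∧ keep K x y
  ; sym    = λ x y → cong₂ _∧_ (Graph.sym G x y) (EdgeFilter.keep-sym K x y)
  ; irrefl = λ x → cong (_∧ keep K x x) (irrefl G x)
  }

module _ (G : Graph n) (K : EdgeFilter n) {x y : Fin n} where

  ↾⁻ : T (adj (G ↾ K) x y) → T (adj G x y) × T (keep K x y)
  ↾⁻ = Equivalence.to T-∧

  ↾⁺ : T (adj G x y) → T (keep K x y) → T (adj (G ↾ K) x y)
  ↾⁺ xy k = Equivalence.from T-∧ (xy , k)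

_↾ˡ_ : {G : Graph n} → Labeling G → (K : EdgeFilter n) → Labeling (G ↾ K)
_↾ˡ_ {G = G} L K = record
  { lab  = lab L
  ; lsym = λ x y xy → lsym L x y (proj₁ (↾⁻ G K xy))
  ; lpos = λ x y xy → lpos L x y (proj₁ (↾⁻ G K xy))
  }

module _ {G : Graph n} {L : Labeling G} (K : EdgeFilter n) where

  private
    π-↾ : ∀ k → π (G ↾ K) (L ↾ˡ K) k ⊆ᴱ π G L k
    π-↾ k {x} {y} (xy , xy≡k) = proj₁ (↾⁻ G K xy) , xy≡k

  -- Filtering edges preserves (ML1) and (ML2) for free; (ML3) survives as long
  -- as no edge through a counted common neighbour is removed.
  ↾-MAT : IsMATLabeling G L →
    (∀ k u v w → π (G ↾ K) (L ↾ˡ K) (suc k) u v → T (CommonBelow G L k u v w) →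
       T (keep K u w) × T (keep K v w)) →
    IsMATLabeling (G ↾ K) (L ↾ˡ K)
  ↾-MAT mat kept (suc k) 1≤k with mat (suc k) 1≤k
  ... | forest , path-free , common =
      Forest-anti-mono (π-↾ (suc k)) forest
    , (λ u v (uv , uv≤k) path → path-free u v (proj₁ (↾⁻ G K uv) , uv≤k) (Connected-mono (π-↾ (suc k)) path))
    , λ u v uv → begin
        commonBelow (G ↾ K) (L ↾ˡ K) k u v   ≡⟨ commonBelow≡count (G ↾ K) (L ↾ˡ K) k u v ⟩
        count (CommonBelow (G ↾ K) (L ↾ˡ K) k u v) ≡⟨ ≤-antisym (count-mono (λ w → drop {u} {v} {w}))
                                                                (count-mono (add uv)) ⟩
        count (CommonBelow G L k u v)         ≡⟨ commonBelow≡count G L k u v ⟨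
        commonBelow G L k u v                 ≡⟨ common u v (π-↾ (suc k) uv) ⟩
        k                                     ∎
    where
      open ≡-Reasoning
      drop : ∀ {u v w} → T (CommonBelow (G ↾ K) (L ↾ˡ K) k u v w) → T (CommonBelow G L k u v w)
      drop c = let ((uw , uw≤k) , (vw , vw≤k)) = CommonBelow⁻ (G ↾ K) (L ↾ˡ K) c
               in CommonBelow⁺ G L (proj₁ (↾⁻ G K uw)) uw≤k (proj₁ (↾⁻ G K vw)) vw≤k
      add : ∀ {u v} → π (G ↾ K) (L ↾ˡ K) (suc k) u v → ∀ w → T (CommonBelow G L k u v w) →
        T (CommonBelow (G ↾ K) (L ↾ˡ K) k u v w)
      add uv w c = let ((uw , uw≤k) , (vw , vw≤k)) = CommonBelow⁻ G L c ; (ku , kv) = kept k _ _ w uv c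
                   in CommonBelow⁺ (G ↾ K) (L ↾ˡ K) (↾⁺ G K uw ku) uw≤k (↾⁺ G K vw kv) vw≤k

edgeCount : Graph n → ℕ
edgeCount G = sumᶠ (λ x → count (adj G x))

↾-edgeCount-< : ∀ {G : Graph n} K {a b} → T (adj G a b) → ¬ T (keep K a b) →
  edgeCount (G ↾ K) < edgeCount G
↾-edgeCount-< {G = G} K {a} {b} ab ¬kept =
  sumᶠ-strict (λ x → count-mono (drop x)) a (count-strict (drop a) b ab (¬kept ∘ proj₂ ∘ ↾⁻ G K))
  where
    drop : ∀ x y → T (adj (G ↾ K) x y) → T (adj G x y)
    drop x y = proj₁ ∘ ↾⁻ G K

module _ {G : Graph n} {L : Labeling G} (K : EdgeFilter n) {x : Fin n} where

  ↾-distinct : (∀ u → T (adj G x u) → T (keep K x u)) →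
    DistinctLabelsAt (G ↾ K) (L ↾ˡ K) x → DistinctLabelsAt G L x
  ↾-distinct kept distinct u w xu xw = distinct u w (↾⁺ G K xu (kept u xu)) (↾⁺ G K xw (kept w xw))

  ↾-distinct-except : ∀ {y} → (∀ u → T (adj G x u) → u ≢ y → T (keep K x u)) →
    (∀ u → T (adj G x u) → lab L x u ≡ lab L x y → u ≡ y) →
    DistinctLabelsAt (G ↾ K) (L ↾ˡ K) x → DistinctLabelsAt G L x
  ↾-distinct-except {y} kept unique distinct u w xu xw xu≡xw with u ≟ y | w ≟ y
  ... | yes refl | _        = sym (unique w xw (sym xu≡xw))
  ... | no _     | yes refl = unique u xu xu≡xw
  ... | no u≢y   | no w≢y   = distinct u w (↾⁺ G K xu (kept u xu u≢y)) (↾⁺ G K xw (kept w xw w≢y)) xu≡xw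

SameEdge : Fin n → Fin n → Fin n → Fin n → Set
SameEdge a b x y = (x ≡ a × y ≡ b) ⊎ (x ≡ b × y ≡ a)

SameEdge-sym : ∀ {a b x y : Fin n} → SameEdge a b x y → SameEdge a b y x
SameEdge-sym (inj₁ (x≡a , y≡b)) = inj₂ (y≡b , x≡a)
SameEdge-sym (inj₂ (x≡b , y≡a)) = inj₁ (y≡a , x≡b)

sameEdge? : (a b x y : Fin n) → Dec (SameEdge a b x y)
sameEdge? a b x y = (x ≟ a ×-dec y ≟ b) ⊎-dec (x ≟ b ×-dec y ≟ a)

without : Fin n → Fin n → EdgeFilter n
without a b = record { keep = λ x y → isNo (sameEdge? a b x y) ; keep-sym = keep-sym }
  where
    keep-sym : ∀ x y → isNo (sameEdge? a b x y) ≡ isNo (sameEdge? a b y x)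
    keep-sym x y with sameEdge? a b x y | sameEdge? a b y x
    ... | yes _  | yes _  = refl
    ... | no _   | no _   = refl
    ... | yes xy | no ¬yx = ⊥-elim (¬yx (SameEdge-sym xy))
    ... | no ¬xy | yes yx = ⊥-elim (¬xy (SameEdge-sym yx))

isolate : Fin n → EdgeFilter n
isolate v = record { keep = λ x y → isNo (x ≟ v) ∧ isNo (y ≟ v) ; keep-sym = λ x y → ∧-comm (isNo (x ≟ v)) _ }

module _ {a b x y : Fin n} where

  without⁻ : ¬ T (keep (without a b) x y) → SameEdge a b x y
  without⁻ ¬kept with sameEdge? a b x y
  ... | yes same = same
  ... | no _     = ⊥-elim (¬kept _)

  without⁺ : ¬ SameEdge a b x y → T (keep (without a b) x y)
  without⁺ = fromWitnessFalse

module _ {v x y : Fin n} where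

  isolate⁻ : T (keep (isolate v) x y) → x ≢ v × y ≢ v
  isolate⁻ t = let (x≢v , y≢v) = Equivalence.to (T-∧ {isNo (x ≟ v)}) t in toWitnessFalse x≢v , toWitnessFalse y≢v

  isolate⁺ : x ≢ v → y ≢ v → T (keep (isolate v) x y)
  isolate⁺ x≢v y≢v = Equivalence.from (T-∧ {isNo (x ≟ v)}) (fromWitnessFalse x≢v , fromWitnessFalse y≢v)

module _ {G : Graph n} {L : Labeling G} (mat : IsMATLabeling G L) where

  without-max-MAT : ∀ {a b} → IsMaxEdge G L a b →
    IsMATLabeling (G ↾ without a b) (L ↾ˡ without a b)
  without-max-MAT {a} {b} (ab , max) = ↾-MAT {L = L} (without a b) mat kept
    where
      below-max-kept : ∀ {x y} → T (adj G x y) → lab L x y < lab L a b →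
        T (keep (without a b) x y)
      below-max-kept xy lt = without⁺ λ
        { (inj₁ (refl , refl)) → <-irrefl refl lt
        ; (inj₂ (refl , refl)) → <-irrefl (lsym L _ _ xy) lt }
      kept : ∀ k u v w → π (G ↾ without a b) (L ↾ˡ without a b) (suc k) u v →
        T (CommonBelow G L k u v w) →
        T (keep (without a b) u w) × T (keep (without a b) v w)
      kept k u v w (uv , uv≡1+k) common =
        let ((uw , uw≤k) , (vw , vw≤k)) = CommonBelow⁻ G L common
            1+k≤ab = subst (_≤ lab L a b) uv≡1+k (max u v (proj₁ (↾⁻ G (without a b) uv)))
        in below-max-kept uw (≤-trans (s≤s uw≤k) 1+k≤ab) , below-max-kept vw (≤-trans (s≤s vw≤k) 1+k≤ab)

  -- By (MS3), the neighbours of v span only edges labelled below their edges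
  -- to v, so v is never a counted common neighbour of an edge avoiding v.
  isolate-MAT : ∀ {v} → IsMATSimplicial G L v → IsMATLabeling (G ↾ isolate v) (L ↾ˡ isolate v)
  isolate-MAT {v} (_ , _ , _ , ms3) = ↾-MAT {L = L} (isolate v) mat kept
    where
      kept : ∀ k x y w → π (G ↾ isolate v) (L ↾ˡ isolate v) (suc k) x y →
        T (CommonBelow G L k x y w) →
        T (keep (isolate v) x w) × T (keep (isolate v) y w)
      kept k x y w (xy , xy≡1+k) common =
        isolate⁺ x≢v w≢v , isolate⁺ y≢v w≢v
        where
          open ≤-Reasoning
          xy′ : T (adj G x y)
          xy′ = proj₁ (↾⁻ G (isolate v) xy)
          x≢v : x ≢ v
          x≢v = proj₁ (isolate⁻ (proj₂ (↾⁻ G (isolate v) xy)))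
          y≢v : y ≢ v
          y≢v = proj₂ (isolate⁻ (proj₂ (↾⁻ G (isolate v) xy)))
          w≢v : w ≢ v
          w≢v refl =
            let ((xw , xw≤k) , (yw , yw≤k)) = CommonBelow⁻ G L common
            in <-irrefl refl (begin-strict
              suc k                    ≡⟨ xy≡1+k ⟨
              lab L x y                <⟨ ms3 x y (adj-sym G xw) (adj-sym G yw) (adj⇒≢ G xy′) ⟩
              lab L x w ⊔ lab L y w    ≤⟨ ⊔-lub xw≤k yw≤k ⟩
              k                        <⟨ n<1+n k ⟩
              suc k                    ∎)

without-keeps-at : ∀ {a b x y u : Fin n} → SameEdge a b x y → x ≢ u → u ≢ y →
  T (keep (without a b) x u)
without-keeps-at (inj₁ (refl , refl)) x≢u u≢y = without⁺ λ
  { (inj₁ (_ , u≡b)) → u≢y u≡b ; (inj₂ (_ , u≡a)) → x≢u (sym u≡a) }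
without-keeps-at (inj₂ (refl , refl)) x≢u u≢y = without⁺ λ
  { (inj₁ (_ , u≡b)) → x≢u (sym u≡b) ; (inj₂ (_ , u≡a)) → u≢y u≡a }

without-keeps-off : ∀ {a b x u : Fin n} → x ≢ a → x ≢ b → T (keep (without a b) x u)
without-keeps-off x≢a x≢b = without⁺ λ { (inj₁ (x≡a , _)) → x≢a x≡a ; (inj₂ (x≡b , _)) → x≢b x≡b }

without-removes : ∀ (a b : Fin n) → ¬ T (keep (without a b) a b)
without-removes a b kept = toWitnessFalse kept (inj₁ (refl , refl))

NonAdjacentIn : Graph n → (Fin n → Bool) → Fin n → Fin n → Set
NonAdjacentIn G S a b = T (S a) × T (S b) × a ≢ b × ¬ T (adj G a b)

DistinctPair : (G : Graph n) → Labeling G → (Fin n → Bool) → Set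
DistinctPair G L S = ∃[ a ] ∃[ b ] NonAdjacentIn G S a b × DistinctLabelsAt G L a × DistinctLabelsAt G L b

nonAdjacentIn? : ∀ (G : Graph n) S a b → Dec (NonAdjacentIn G S a b)
nonAdjacentIn? G S a b = T? (S a) ×-dec T? (S b) ×-dec ¬? (a ≟ b) ×-dec ¬? (T? (adj G a b))

-- Graphs live on Fin n, so instead of deleting vertices the induction restricts
-- attention to a set S outside of which all vertices are isolated.
Claim : (G : Graph n) → Labeling G → (Fin n → Bool) → Set
Claim G L S =
    (CliqueOn G S → ∀ {a b} → IsMaxEdge G L a b → DistinctLabelsAt G L a × DistinctLabelsAt G L b)
  × (∀ {a b} → NonAdjacentIn G S a b → DistinctPair G L S)

module EdgeDeletion {G : Graph n} {L : Labeling G} {S : Fin n → Bool}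
  (mat : IsMATLabeling G L) (within : Within G S)
  (ih : ∀ {H : Graph n} (LH : Labeling H) → edgeCount H < edgeCount G →
          IsMATLabeling H LH → Within H S → Claim H LH S) where

  open MATLabeling {L = L} mat

  ends-of-max-edge : ∀ {a b} → IsMaxEdge G L a b → DistinctPair (G ↾ without a b) (L ↾ˡ without a b) S
  ends-of-max-edge {a} {b} max@(ab , _) =
    proj₂ (ih {H = G ↾ without a b} (L ↾ˡ without a b) (↾-edgeCount-< {G = G} (without a b) ab (without-removes a b))
              (without-max-MAT {L = L} mat max) (λ x y xy → within x y (proj₁ (↾⁻ G (without a b) xy))))
      (within a b ab , within b a (adj-sym G ab) , adj⇒≢ G ab ,
       λ ab′ → without-removes a b (proj₂ (↾⁻ G (without a b) ab′)))

  endpoint-distinct : CliqueOn G S → ∀ {a b x y} → IsMaxEdge G L x y → SameEdge a b x y →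
    DistinctLabelsAt (G ↾ without a b) (L ↾ˡ without a b) x → DistinctLabelsAt G L x
  endpoint-distinct clique {a} {b} {x} {y} max@(xy , _) same = ↾-distinct-except {L = L} (without a b)
    (λ u xu u≢y → without-keeps-at same (adj⇒≢ G xu) u≢y)
    λ u xu xu≡xy → decidable-stable (u ≟ y) λ u≢y →
      <-irrefl xu≡xy (max-edge-triangle max xu
        (clique y u (within y x (adj-sym G xy)) (within u x (adj-sym G xu)) (≢-sym u≢y)))

  ends-distinct : CliqueOn G S → ∀ {a b} → IsMaxEdge G L a b →
    DistinctLabelsAt (G ↾ without a b) (L ↾ˡ without a b) a →
    DistinctLabelsAt (G ↾ without a b) (L ↾ˡ without a b) b →
    DistinctLabelsAt G L a × DistinctLabelsAt G L b
  ends-distinct clique max distinct-a distinct-b =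
      endpoint-distinct clique max (inj₁ (refl , refl)) distinct-a
    , endpoint-distinct clique (IsMaxEdge-sym {L = L} max) (inj₂ (refl , refl)) distinct-b

  clique-case : CliqueOn G S → ∀ {a b} → IsMaxEdge G L a b →
    DistinctLabelsAt G L a × DistinctLabelsAt G L b
  clique-case clique {a} {b} max with ends-of-max-edge max
  ... | a′ , b′ , (Sa′ , Sb′ , a′≢b′ , ¬a′b′) , distinct-a′ , distinct-b′
      with without⁻ (λ kept → ¬a′b′ (↾⁺ G (without a b) (clique a′ b′ Sa′ Sb′ a′≢b′) kept))
  ... | inj₁ (refl , refl) = ends-distinct clique max distinct-a′ distinct-b′
  ... | inj₂ (refl , refl) = ends-distinct clique max distinct-b′ distinct-a′

  private
    leaf-of-max : ∀ {c d} → IsMaxEdge G L c d →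
      ∃[ u ] ∃[ v ] π G L (lab L c d) u v × (∀ w → π G L (lab L c d) u w → w ≡ v)
    leaf-of-max {c} {d} (cd , _) = forest-leaf
      (λ x y → T? (adj G x y) ×-dec (lab L x y ℕ.≟ lab L c d))
      (λ (xy , xy≡m) → adj-sym G xy , trans (sym (lsym L _ _ xy)) xy≡m)
      (λ (xx , _) → adj⇒≢ G xx refl)
      (proj₁ (mat (lab L c d) (lpos L c d cd)))
      (cd , refl)

  -- A leaf edge uv of the forest of maximal labels has a unique label at u, so
  -- deleting it loses distinctness neither at u nor away from u and v.
  distinct-vertex : ∀ {s} → T (S s) → ∃[ v ] T (S v) × DistinctLabelsAt G L v
  distinct-vertex {s} Ss with Fin.any? (λ x → Fin.any? (λ y → T? (adj G x y)))
  ... | no no-edge = s , Ss , λ u _ su → ⊥-elim (no-edge (s , u , su))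
  ... | yes (x , y , xy) with max-edge L xy
  ... | c , d , max@(_ , below) with leaf-of-max max
  ... | u , v , (uv , uv≡m) , only = pick (ends-of-max-edge max′)
    where
      max′ : IsMaxEdge G L u v
      max′ = uv , λ x y xy → subst (lab L x y ≤_) (sym uv≡m) (below x y xy)
      lift : ∀ {x} → x ≢ v → DistinctLabelsAt (G ↾ without u v) (L ↾ˡ without u v) x → DistinctLabelsAt G L x
      lift {x} x≢v = lift-by (x ≟ u)
        where
          lift-by : Dec (x ≡ u) → DistinctLabelsAt (G ↾ without u v) (L ↾ˡ without u v) x →
            DistinctLabelsAt G L x
          lift-by (yes refl) = ↾-distinct-except {L = L} (without u v)
            (λ w xw w≢v → without-keeps-at (inj₁ (refl , refl)) (adj⇒≢ G xw) w≢v)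
            (λ w xw xw≡xv → only w (xw , trans xw≡xv uv≡m))
          lift-by (no x≢u) = ↾-distinct {L = L} (without u v) (λ w _ → without-keeps-off x≢u x≢v)
      pick : DistinctPair (G ↾ without u v) (L ↾ˡ without u v) S → ∃[ v ] T (S v) × DistinctLabelsAt G L v
      pick (a₁ , b₁ , (Sa₁ , Sb₁ , a₁≢b₁ , _) , distinct-a₁ , distinct-b₁) = choose (a₁ ≟ v)
        where
          choose : Dec (a₁ ≡ v) → ∃[ v ] T (S v) × DistinctLabelsAt G L v
          choose (yes a₁≡v) = b₁ , Sb₁ , lift (λ b₁≡v → a₁≢b₁ (trans a₁≡v (sym b₁≡v))) distinct-b₁
          choose (no a₁≢v)  = a₁ , Sa₁ , lift a₁≢v distinct-a₁

module AroundDistinctVertex {G : Graph n} {L : Labeling G} {S : Fin n → Bool}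
  (mat : IsMATLabeling G L) (within : Within G S)
  (ih : ∀ {H : Graph n} (LH : Labeling H) S′ → edgeCount H + count S′ < edgeCount G + count S →
          IsMATLabeling H LH → Within H S′ → Claim H LH S′)
  {v₀ : Fin n} (Sv₀ : T (S v₀)) (distinct-v₀ : DistinctLabelsAt G L v₀) where

  S′ : Fin n → Bool
  S′ = S ∖ v₀

  private
    S′-smaller : count S′ < count S
    S′-smaller = ≤-reflexive (sym (count-∖ S v₀ Sv₀))

    pair-with-v₀ : ∀ {x} → T (S′ x) → ¬ T (adj G v₀ x) → DistinctLabelsAt G L x → DistinctPair G L S
    pair-with-v₀ {x} Sx′ ¬v₀x distinct-x =
      let (Sx , x≢v₀) = ∖⁻ S Sx′ in v₀ , x , (Sv₀ , Sx , ≢-sym x≢v₀ , ¬v₀x) , distinct-v₀ , distinct-x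

    split : ∀ {a b} → NonAdjacentIn G S a b →
      (∃[ w ] T (S′ w) × ¬ T (adj G v₀ w)) ⊎ NonAdjacentIn G S′ a b
    split {a} {b} (Sa , Sb , a≢b , ¬ab) = by (a ≟ v₀) (b ≟ v₀)
      where
        by : Dec (a ≡ v₀) → Dec (b ≡ v₀) → (∃[ w ] T (S′ w) × ¬ T (adj G v₀ w)) ⊎ NonAdjacentIn G S′ a b
        by (yes a≡v₀) _ = inj₁ (b , ∖⁺ S Sb (λ b≡v₀ → a≢b (trans a≡v₀ (sym b≡v₀))) ,
                                subst (λ z → ¬ T (adj G z b)) a≡v₀ ¬ab)
        by (no a≢v₀) (yes b≡v₀) = inj₁ (a , ∖⁺ S Sa a≢v₀ , subst (λ z → ¬ T (adj G z a)) b≡v₀ (¬ab ∘ adj-sym G))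
        by (no a≢v₀) (no b≢v₀)  = inj₂ (∖⁺ S Sa a≢v₀ , ∖⁺ S Sb b≢v₀ , a≢b , ¬ab)

  isolated-case : (∀ y → ¬ T (adj G v₀ y)) → ∀ {a b} → NonAdjacentIn G S a b → DistinctPair G L S
  isolated-case isolated {a} nonadj =
    let (x , Sx′ , distinct-x) = EdgeDeletion.distinct-vertex {L = L} {S = S′} mat within′
          (λ LH fewer → ih LH S′ (+-mono-< fewer S′-smaller)) (proj₂ (vertex-of-S′ (split nonadj)))
    in pair-with-v₀ Sx′ (isolated x) distinct-x
    where
      within′ : Within G S′
      within′ x y xy = ∖⁺ S (within x y xy) λ { refl → isolated y xy }
      vertex-of-S′ : ∀ {b} → (∃[ w ] T (S′ w) × ¬ T (adj G v₀ w)) ⊎ NonAdjacentIn G S′ a b → ∃[ w ] T (S′ w)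
      vertex-of-S′ (inj₁ (w , Sw′ , _)) = w , Sw′
      vertex-of-S′ (inj₂ (Sa′ , _))     = a , Sa′

  private
    G′ : Graph n
    G′ = G ↾ isolate v₀

    L′ : Labeling G′
    L′ = L ↾ˡ isolate v₀

    simplicial-v₀ : IsMATSimplicial G L v₀
    simplicial-v₀ = distinct⇒MAT-simplicial {L = L} mat distinct-v₀

    mat′ : IsMATLabeling G′ L′
    mat′ = isolate-MAT {G = G} {L = L} mat {v₀} simplicial-v₀

    within′ : Within G′ S′
    within′ x y xy′ = let (xy , kept) = ↾⁻ G (isolate v₀) xy′ in ∖⁺ S (within x y xy) (proj₁ (isolate⁻ kept))

    N[v₀]⊆S′ : ∀ u → T (adj G v₀ u) → T (S′ u)
    N[v₀]⊆S′ u v₀u = ∖⁺ S (within u v₀ (adj-sym G v₀u)) (≢-sym (adj⇒≢ G v₀u))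

    pair-with-v₀′ : ∀ {x} → T (S′ x) → ¬ T (adj G v₀ x) → DistinctLabelsAt G′ L′ x → DistinctPair G L S
    pair-with-v₀′ {x} Sx′ ¬v₀x distinct′ = pair-with-v₀ Sx′ ¬v₀x (↾-distinct {L = L} (isolate v₀)
      (λ u xu → isolate⁺ (proj₂ (∖⁻ S Sx′)) λ { refl → ¬v₀x (adj-sym G xu) }) distinct′)

    -- A maximal edge cd of G′ inside N(v₀) would force deg v₀ > lab c d by (MS2)
    -- and (MS3), while a clique S′ containing N(v₀) and one more vertex has at
    -- most lab c d + 1 vertices.
    crowded : CliqueOn G′ S′ → ∀ {c d w₀} → IsMaxEdge G′ L′ c d → T (adj G v₀ c) → T (adj G v₀ d) →
      T (S′ w₀) → ¬ T (adj G v₀ w₀) → ⊥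
    crowded clique′ {c} {d} {w₀} max′@(cd′ , _) v₀c v₀d Sw₀′ ¬v₀w₀ = <-irrefl refl (begin-strict
      suc (lab L c d)            ≤⟨ ms3 c d v₀c v₀d (adj⇒≢ G (proj₁ (↾⁻ G (isolate v₀) cd′))) ⟩
      lab L c v₀ ⊔ lab L d v₀    ≤⟨ ⊔-lub (proj₂ (ms2 c (adj-sym G v₀c))) (proj₂ (ms2 d (adj-sym G v₀d))) ⟩
      deg G L v₀                 ≡⟨ deg≡count G L v₀ ⟩
      count (adj G v₀)           <⟨ count-strict N[v₀]⊆S′ w₀ Sw₀′ ¬v₀w₀ ⟩
      count S′                   ≤⟨ MATLabeling.clique-count-≤ {G = G′} {L = L′} mat′ within′ clique′ max′ ⟩
      suc (lab L c d)            ∎)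
      where
        open ≤-Reasoning
        ms2 : ∀ u → T (adj G u v₀) → 1 ≤ lab L u v₀ × lab L u v₀ ≤ deg G L v₀
        ms2 = proj₁ (proj₂ simplicial-v₀)
        ms3 : ∀ u₁ u₂ → T (adj G v₀ u₁) → T (adj G v₀ u₂) → u₁ ≢ u₂ →
          lab L u₁ u₂ < lab L u₁ v₀ ⊔ lab L u₂ v₀
        ms3 = proj₂ (proj₂ (proj₂ simplicial-v₀))

    claim′ : ∀ {y₀} → T (adj G v₀ y₀) → Claim G′ L′ S′
    claim′ {y₀} v₀y₀ = ih L′ S′ (+-mono-< (↾-edgeCount-< {G = G} (isolate v₀) v₀y₀
      (λ kept → proj₁ (isolate⁻ {v = v₀} {x = v₀} {y = y₀} kept) refl)) S′-smaller) mat′ within′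

    non-clique′-case : ∀ {y₀} → T (adj G v₀ y₀) → ∀ {x y} → NonAdjacentIn G′ S′ x y → DistinctPair G L S
    non-clique′-case v₀y₀ nonadj′ with proj₂ (claim′ v₀y₀) nonadj′
    ... | a₂ , b₂ , (Sa₂′ , Sb₂′ , a₂≢b₂ , ¬a₂b₂′) , distinct-a₂ , distinct-b₂
        with T? (adj G v₀ a₂) | T? (adj G v₀ b₂)
    ... | no ¬v₀a₂ | _        = pair-with-v₀′ Sa₂′ ¬v₀a₂ distinct-a₂
    ... | yes _    | no ¬v₀b₂ = pair-with-v₀′ Sb₂′ ¬v₀b₂ distinct-b₂
    ... | yes v₀a₂ | yes v₀b₂ = ⊥-elim (¬a₂b₂′ (↾⁺ G (isolate v₀)
          (proj₁ simplicial-v₀ a₂ b₂ v₀a₂ v₀b₂ a₂≢b₂)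
          (isolate⁺ (proj₂ (∖⁻ S Sa₂′)) (proj₂ (∖⁻ S Sb₂′)))))

    clique′-case : ∀ {y₀} → T (adj G v₀ y₀) → CliqueOn G′ S′ → ∀ {a b} → NonAdjacentIn G S a b →
      DistinctPair G L S
    clique′-case v₀y₀ clique′ nonadj with split nonadj
    ... | inj₂ (Sa′ , Sb′ , a≢b , ¬ab) = ⊥-elim (¬ab (proj₁ (↾⁻ G (isolate v₀) (clique′ _ _ Sa′ Sb′ a≢b))))
    ... | inj₁ (w₀ , Sw₀′ , ¬v₀w₀)
        with max-edge L′ (clique′ _ w₀ (N[v₀]⊆S′ _ v₀y₀) Sw₀′ λ { refl → ¬v₀w₀ v₀y₀ })
    ... | c , d , max′@(cd′ , _)
        with proj₁ (claim′ v₀y₀) clique′ max′ | T? (adj G v₀ c) | T? (adj G v₀ d)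
    ... | distinct-c , _ | no ¬v₀c | _       = pair-with-v₀′ (within′ c d cd′) ¬v₀c distinct-c
    ... | _ , distinct-d | yes _   | no ¬v₀d = pair-with-v₀′ (within′ d c (adj-sym G′ cd′)) ¬v₀d distinct-d
    ... | _              | yes v₀c | yes v₀d = ⊥-elim (crowded clique′ max′ v₀c v₀d Sw₀′ ¬v₀w₀)

  neighbour-case : ∀ {y₀} → T (adj G v₀ y₀) → ∀ {a b} → NonAdjacentIn G S a b → DistinctPair G L S
  neighbour-case v₀y₀ nonadj with Fin.any? (λ x → Fin.any? (λ y → nonAdjacentIn? G′ S′ x y))
  ... | yes (_ , _ , nonadj′) = non-clique′-case v₀y₀ nonadj′
  ... | no no-pair = clique′-case v₀y₀ clique′ nonadj
    where
      clique′ : CliqueOn G′ S′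
      clique′ x y Sx′ Sy′ x≢y =
        decidable-stable (T? (adj G′ x y)) λ ¬xy → no-pair (x , y , Sx′ , Sy′ , x≢y , ¬xy)

claim-step : ∀ {G : Graph n} {L : Labeling G} {S} → IsMATLabeling G L → Within G S →
  (∀ {H : Graph n} (LH : Labeling H) S′ → edgeCount H + count S′ < edgeCount G + count S →
     IsMATLabeling H LH → Within H S′ → Claim H LH S′) →
  Claim G L S
claim-step {n} {G} {L} {S} mat within ih = EdgeDeletion.clique-case {L = L} mat within ih-edges , non-clique
  where
    ih-edges : ∀ {H : Graph n} (LH : Labeling H) → edgeCount H < edgeCount G →
      IsMATLabeling H LH → Within H S → Claim H LH S
    ih-edges LH fewer = ih LH S (+-monoˡ-< (count S) fewer)
    non-clique : ∀ {a b} → NonAdjacentIn G S a b → DistinctPair G L S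
    non-clique nonadj@(Sa , _) with EdgeDeletion.distinct-vertex {L = L} mat within ih-edges Sa
    ... | v₀ , Sv₀ , distinct-v₀ with Fin.any? (λ y → T? (adj G v₀ y))
    ... | yes (_ , v₀y₀) = AroundDistinctVertex.neighbour-case {L = L} mat within ih Sv₀ distinct-v₀ v₀y₀ nonadj
    ... | no isolated    = AroundDistinctVertex.isolated-case {L = L} mat within ih Sv₀ distinct-v₀
                             (λ y v₀y → isolated (y , v₀y)) nonadj

claim : ∀ bound {G : Graph n} (L : Labeling G) S → edgeCount G + count S < bound →
  IsMATLabeling G L → Within G S → Claim G L S
claim (suc bound) L S small mat within =
  claim-step {L = L} mat within λ LH S′ smaller → claim bound LH S′ (≤-trans smaller (≤-pred small))

lemma5p2 : ∀ (n : ℕ) → 2 ≤ n → (G : Graph n) → (L : Labeling G) → IsMATLabeling G L →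
    ((Complete G → ∀ (a b : Fin n) → T (adj G a b) →
        (∀ (c d : Fin n) → T (adj G c d) → lab L c d ≤ lab L a b) →
        IsMATSimplicial G L a × IsMATSimplicial G L b)
    × (¬ Complete G → ∃[ a ] ∃[ b ] (a ≢ b × ¬ T (adj G a b)
        × IsMATSimplicial G L a × IsMATSimplicial G L b)))
lemma5p2 n _ G L mat = complete-case , incomplete-case
  where
    everything : Fin n → Bool
    everything = const true
    claims : Claim G L everything
    claims = claim (suc (edgeCount G + count everything)) L everything ≤-refl mat (λ _ _ _ → _)
    simplicial : ∀ {v} → DistinctLabelsAt G L v → IsMATSimplicial G L v
    simplicial = distinct⇒MAT-simplicial {L = L} mat
    complete-case : Complete G → ∀ a b → T (adj G a b) → (∀ c d → T (adj G c d) → lab L c d ≤ lab L a b) →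
      IsMATSimplicial G L a × IsMATSimplicial G L b
    complete-case complete a b ab max =
      let (distinct-a , distinct-b) = proj₁ claims (λ x y _ _ → complete x y) (ab , max)
      in simplicial distinct-a , simplicial distinct-b
    incomplete-case : ¬ Complete G →
      ∃[ a ] ∃[ b ] (a ≢ b × ¬ T (adj G a b) × IsMATSimplicial G L a × IsMATSimplicial G L b)
    incomplete-case incomplete with Fin.any? (λ x → Fin.any? (λ y → nonAdjacentIn? G everything x y))
    ... | no none = ⊥-elim (incomplete λ x y x≢y →
          decidable-stable (T? (adj G x y)) λ ¬xy → none (x , y , _ , _ , x≢y , ¬xy))
    ... | yes (_ , _ , nonadj) =
      let (a , b , (_ , _ , a≢b , ¬ab) , distinct-a , distinct-b) = proj₂ claims nonadj
      in a , b , a≢b , ¬ab , simplicial distinct-a , simplicial distinct-b
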